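{- Let $P(X)=X^4+c_3X^3+c_2X^2+c_1X+c_0\in\mathbb{Z}[X]$ be monic and irreducible with roots $r_1,r_2,r_3,r_4$. With the notation of the context, let $R(a_1,a_2,a_3)$ be the resultant of $B_{14}$ and $N_P(\alpha)$ with respect to $a_0$, and let $t_P\in\mathbb{Q}^*$ be the constant such that \[R(a_1,a_2,a_3)=t_P\prod_{1\le i<j\le4}(a(r_i)-a(r_j))^2 .\] Then \[t_P=\prod_{1\le i<j\le 4}\frac{1}{(r_i-r_j)^2}.\]
   Context: Let $a_0,\dots,a_3$ be indeterminates, $a(X)=a_0+a_1X+a_2X^2+a_3X^3$, $\alpha=a(r_1)$. $M_\alpha$ is the $4\times4$ matrix of multiplication by $\alpha$ on $\mathbb{Q}(r_1)$ in the basis $1,r_1,r_1^2,r_1^3$ (columns are coordinates of $\alpha r_1^{j-1}$), $N_P(\alpha)=\det M_\alpha$, and $B_{ij}$ is $(-1)^{i+j}$ times the determinant of $M_\alpha$ with row $i$ and column $j$ deleted; these are polynomials in $a_0,\dots,a_3$. It is known that a constant $t_P\in\mathbb{Q}^*$ with $R=t_P\prod_{i<j}(a(r_i)-a(r_j))^2$ exists (and $R$ does not depend on $a_0$). -}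

module Defs where

open import Level using (Level; _⊔_)
open import Data.Bool using (Bool; true; false; _∧_; if_then_else_)
open import Data.Nat as ℕ using (ℕ; zero; suc; _∸_; _<ᵇ_; _≤ᵇ_)
open import Data.Integer as ℤ using (ℤ; +_)
open import Data.Rational as ℚ using (ℚ; _/_)
open import Data.Fin using (Fin; zero; suc; toℕ; punchIn; fromℕ)
open import Data.List using (List; []; _∷_; map; reverse; dropWhileᵇ; foldr; length)
open import Data.Product using (∃; _×_)
open import Data.Sum using (_⊎_)
open import Relation.Nullary using (¬_)
open import Relation.Binary.PropositionalEquality using (_≡_)
open import Algebra.Bundles using (CommutativeRing)

record Ops (A : Set) : Set where
  field
    zeroᵒ : A
    oneᵒ  : A
    addᵒ  : A → A → A
    mulᵒ  : A → A → A
    negᵒ  : A → A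
    isZeroᵒ : A → Bool

open Ops public

ℤOps : Ops ℤ
ℤOps = record
  { zeroᵒ = + 0 ; oneᵒ = + 1 ; addᵒ = ℤ._+_ ; mulᵒ = ℤ._*_ ; negᵒ = ℤ.-_
  ; isZeroᵒ = λ z → ℕ._≡ᵇ_ (ℤ.∣ z ∣) 0 }

-- Dense univariate polynomials over A: coefficient lists, constant term first
-- (trailing zeros allowed; 'strip' normalises).
module _ {A : Set} (o : Ops A) where
  addL : List A → List A → List A
  addL [] q = q
  addL (x ∷ p) [] = x ∷ p
  addL (x ∷ p) (y ∷ q) = addᵒ o x y ∷ addL p q

  mulL : List A → List A → List A
  mulL [] q = []
  mulL (x ∷ p) q = addL (map (mulᵒ o x) q) (zeroᵒ o ∷ mulL p q)

  strip : List A → List A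
  strip p = reverse (dropWhileᵇ (isZeroᵒ o) (reverse p))

  coeff : List A → ℕ → A
  coeff [] k = zeroᵒ o
  coeff (x ∷ p) zero = x
  coeff (x ∷ p) (suc k) = coeff p k

allᵇ : {A : Set} → (A → Bool) → List A → Bool
allᵇ p [] = true
allᵇ p (x ∷ xs) = p x ∧ allᵇ p xs

listOps : {A : Set} → Ops A → Ops (List A)
listOps o = record
  { zeroᵒ = [] ; oneᵒ = oneᵒ o ∷ [] ; addᵒ = addL o ; mulᵒ = mulL o
  ; negᵒ = map (negᵒ o) ; isZeroᵒ = allᵇ (isZeroᵒ o) }

-- Multivariate integer polynomials in n variables x₀,…,x_{n-1}
-- (x₀ outermost): ℤ[x₀,…,x_{n-1}] = (ℤ[x₁,…])[x₀].
MPoly : ℕ → Set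
MPoly zero = ℤ
MPoly (suc n) = List (MPoly n)

mops : (n : ℕ) → Ops (MPoly n)
mops zero = ℤOps
mops (suc n) = listOps (mops n)

constP : (n : ℕ) → ℤ → MPoly n
constP zero z = z
constP (suc n) z = constP n z ∷ []

varP : {n : ℕ} → Fin n → MPoly n
varP {suc n} zero = zeroᵒ (mops n) ∷ oneᵒ (mops n) ∷ []
varP {suc n} (suc k) = varP k ∷ []

module _ {A : Set} (o : Ops A) where
  sumFin : (n : ℕ) → (Fin n → A) → A
  sumFin zero f = zeroᵒ o
  sumFin (suc n) f = addᵒ o (f zero) (sumFin n (λ i → f (suc i)))

  signed : ℕ → A → A
  signed zero x = x
  signed (suc k) x = negᵒ o (signed k x)

  det : (n : ℕ) → (Fin n → Fin n → A) → A
  det zero M = oneᵒ o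
  det (suc n) M = sumFin (suc n) (λ j →
    signed (toℕ j) (mulᵒ o (M zero j) (det n (λ i k → M (suc i) (punchIn j k)))))

  cofactor : (n : ℕ) → (Fin (suc n) → Fin (suc n) → A) → Fin (suc n) → Fin (suc n) → A
  cofactor n M i j = signed (toℕ i ℕ.+ toℕ j) (det n (λ p q → M (punchIn i p) (punchIn j q)))

  -- Resultant of f and g (polynomials in one variable over A) as the
  -- determinant of the Sylvester matrix, with the actual degrees
  -- (leading coefficients nonzero); 0 if one of them is the zero polynomial.
  sylvester : (f g : List A) (m n : ℕ) → Fin (n ℕ.+ m) → Fin (n ℕ.+ m) → A
  sylvester f g m n r c =
    if toℕ r <ᵇ n
    then entry f m (toℕ r)
    else entry g n (toℕ r ∸ n)
    where
    entry : List A → ℕ → ℕ → A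
    entry h d i = if (i ≤ᵇ toℕ c) ∧ ((toℕ c ∸ i) ≤ᵇ d)
                  then coeff o h (d ∸ (toℕ c ∸ i)) else zeroᵒ o

  resultant : List A → List A → A
  resultant f g with strip o f | strip o g
  ... | [] | _ = zeroᵒ o
  ... | _ | [] = zeroᵒ o
  ... | f'@(_ ∷ fs) | g'@(_ ∷ gs) =
    det (length gs ℕ.+ length fs) (sylvester f' g' (length fs) (length gs))

record Quartic : Set where
  constructor quartic
  field c0 c1 c2 c3 : ℤ

module _ (P : Quartic) where
  open Quartic P

  polyP : List ℤ
  polyP = c0 ∷ c1 ∷ c2 ∷ c3 ∷ + 1 ∷ []

  -- coordinates of r₁^k in the basis 1, r₁, r₁², r₁³ of ℚ(r₁)
  -- (reduction of X^k modulo P, using r₁⁴ = -(c3 r₁³ + c2 r₁² + c1 r₁ + c0))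
  coordPow : ℕ → Fin 4 → ℤ
  coordPow zero zero = + 1
  coordPow zero (suc _) = + 0
  coordPow (suc k) i = step i
    where
    v = coordPow k
    top = v (fromℕ 3)
    step : Fin 4 → ℤ
    step zero = ℤ.- (c0 ℤ.* top)
    step (suc zero) = v zero ℤ.- c1 ℤ.* top
    step (suc (suc zero)) = v (suc zero) ℤ.- c2 ℤ.* top
    step (suc (suc (suc zero))) = v (suc (suc zero)) ℤ.- c3 ℤ.* top

  -- M_α ∈ ℤ[a0,a1,a2,a3]^{4×4}: entry (i,j) = i-th coordinate of
  -- α r₁^j = Σ_k a_k r₁^(k+j)   (0-indexed rows/columns)
  Mα : Fin 4 → Fin 4 → MPoly 4
  Mα i j = sumFin (mops 4) 4 (λ k →
    mulᵒ (mops 4) (varP k) (constP 4 (coordPow (toℕ k ℕ.+ toℕ j) i)))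

  NP : MPoly 4
  NP = det (mops 4) 4 Mα

  B14 : MPoly 4
  B14 = cofactor (mops 4) 3 Mα zero (fromℕ 3)

  Rres : MPoly 3
  Rres = resultant (mops 3) B14 NP

ℤXOps : Ops (List ℤ)
ℤXOps = mops 1

_≈ℤX_ : List ℤ → List ℤ → Set
p ≈ℤX q = strip ℤOps p ≡ strip ℤOps q

IsUnitℤX : List ℤ → Set
IsUnitℤX f = ∃ λ g → mulL ℤOps f g ≈ℤX (+ 1 ∷ [])

IrreducibleℤX : List ℤ → Set
IrreducibleℤX p = ¬ (p ≈ℤX []) × ¬ IsUnitℤX p
  × (∀ f g → p ≈ℤX mulL ℤOps f g → IsUnitℤX f ⊎ IsUnitℤX g)

module _ {c ℓ : Level} (K : CommutativeRing c ℓ) where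
  open CommutativeRing K hiding (zero)

  IsFieldWith : (Carrier → Carrier) → Set (c ⊔ ℓ)
  IsFieldWith inv = (¬ 1# ≈ 0#) × (∀ x → ¬ x ≈ 0# → x * inv x ≈ 1#)

  IsRingHomℚ : (ℚ → Carrier) → Set ℓ
  IsRingHomℚ ι = (∀ p q → ι (p ℚ.+ q) ≈ ι p + ι q)
    × (∀ p q → ι (p ℚ.* q) ≈ ι p * ι q) × (ι ℚ.1ℚ ≈ 1#)

  evalP : (ι : ℚ → Carrier) (n : ℕ) → MPoly n → (Fin n → Carrier) → Carrier
  evalP ι zero z x = ι (z / 1)
  evalP ι (suc n) p x = foldr (λ q acc → evalP ι n q (λ i → x (suc i)) + x zero * acc) 0# p

  -- r1,…,r4 are the roots of P in K:  P = (X-r1)(X-r2)(X-r3)(X-r4)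
  AreRoots : (ι : ℚ → Carrier) → Quartic → (r1 r2 r3 r4 : Carrier) → Set ℓ
  AreRoots ι (quartic c0 c1 c2 c3) r1 r2 r3 r4 =
      (ι (c3 / 1) ≈ - (r1 + r2 + r3 + r4))
    × (ι (c2 / 1) ≈ r1 * r2 + r1 * r3 + r1 * r4 + r2 * r3 + r2 * r4 + r3 * r4)
    × (ι (c1 / 1) ≈ - (r1 * r2 * r3 + r1 * r2 * r4 + r1 * r3 * r4 + r2 * r3 * r4))
    × (ι (c0 / 1) ≈ r1 * r2 * r3 * r4)

  sq : Carrier → Carrier
  sq x = x * x

  aEval : (a0 a1 a2 a3 x : Carrier) → Carrier
  aEval a0 a1 a2 a3 x = a0 + a1 * x + a2 * (x * x) + a3 * (x * x * x)

  prodPairs : (Carrier → Carrier → Carrier) → (r1 r2 r3 r4 : Carrier) → Carrier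
  prodPairs f r1 r2 r3 r4 =
    f r1 r2 * f r1 r3 * f r1 r4 * f r2 r3 * f r2 r4 * f r3 r4

  pt3 : (a1 a2 a3 : Carrier) → Fin 3 → Carrier
  pt3 a1 a2 a3 zero = a1
  pt3 a1 a2 a3 (suc zero) = a2
  pt3 a1 a2 a3 (suc (suc zero)) = a3

  IsTP : (ι : ℚ → Carrier) → Quartic → (r1 r2 r3 r4 : Carrier) → ℚ → Set (c ⊔ ℓ)
  IsTP ι P r1 r2 r3 r4 t = ∀ a0 a1 a2 a3 →
    evalP ι 3 (Rres P) (pt3 a1 a2 a3)
      ≈ ι t * prodPairs (λ x y → sq (aEval a0 a1 a2 a3 x - aEval a0 a1 a2 a3 y)) r1 r2 r3 r4

-- Specialising the polynomial a(X) to a(X) = X, i.e. (a₀,a₁,a₂,a₃) = (0,1,0,0), turns the defining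
-- identity of t_P into  R(1,0,0) = t_P · ∏_{i<j} (r_i − r_j)²,  so it suffices that R(1,0,0) = 1.
-- This holds for every monic integer quartic: the coefficients of B₁₄ and N_P as polynomials in a₀
-- are polynomials in a₁,a₂,a₃ and c₀,…,c₃, so the whole computation can be done once for the
-- generic quartic over ℤ[c₀,c₁,c₂,c₃] and then transported to P along the evaluation homomorphism
-- c ↦ (c₀,c₁,c₂,c₃), which commutes with determinants, Sylvester matrices and evaluation.
-- Generically B₁₄ has degree 2 in a₀ with leading coefficient −a₃ and N_P has leading coefficient 1,
-- so the resultant is the determinant of a 6 × 6 Sylvester matrix whose value at (1,0,0) is 1.
module Submission where

open import Defs
open import Level using (Level)
open import Function using (_∘_)
open import Data.Bool using (true; false; _∧_; if_then_else_)
open import Data.Nat as ℕ using (ℕ; zero; suc)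
open import Data.Integer as ℤ using (ℤ; +_; -[1+_])
import Data.Integer.Properties as ℤ
open import Data.Integer.Solver using (module +-*-Solver)
open import Data.Rational as ℚ using (ℚ; 0ℚ; mkℚ)
import Data.Rational.Properties as ℚ
import Data.Nat.Coprimality as Coprime
open import Data.Fin using (Fin; zero; suc; toℕ; fromℕ; inject₁; punchIn)
open import Data.List using (List; []; _∷_; [_]; _∷ʳ_; map; foldr; length; reverse)
open import Data.List.Properties using (reverse-++; unfold-reverse; reverse-involutive)
open import Data.Product using (_×_; _,_; proj₁; proj₂)
open import Data.Empty using (⊥-elim)
open import Relation.Nullary using (¬_)
open import Relation.Binary.PropositionalEquality
  using (_≡_; _≢_; refl; sym; trans; cong; cong₂; module ≡-Reasoning)
open import Algebra.Bundles using (CommutativeRing)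

record IsOpsHom {A B : Set} (oa : Ops A) (ob : Ops B) (h : A → B) : Set where
  field
    0#-homo : h (zeroᵒ oa) ≡ zeroᵒ ob
    1#-homo : h (oneᵒ oa) ≡ oneᵒ ob
    +-homo  : ∀ x y → h (addᵒ oa x y) ≡ addᵒ ob (h x) (h y)
    *-homo  : ∀ x y → h (mulᵒ oa x y) ≡ mulᵒ ob (h x) (h y)
    -‿homo  : ∀ x → h (negᵒ oa x) ≡ negᵒ ob (h x)

module _ {A : Set} (o : Ops A) where

  sumFin-cong : ∀ n {f g : Fin n → A} → (∀ j → f j ≡ g j) → sumFin o n f ≡ sumFin o n g
  sumFin-cong zero    f≡g = refl
  sumFin-cong (suc n) f≡g = cong₂ (addᵒ o) (f≡g zero) (sumFin-cong n (f≡g ∘ suc))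

  det-cong : ∀ n {M N : Fin n → Fin n → A} → (∀ i j → M i j ≡ N i j) → det o n M ≡ det o n N
  det-cong zero    M≡N = refl
  det-cong (suc n) M≡N = sumFin-cong (suc n) λ j → cong (signed o (toℕ j))
    (cong₂ (mulᵒ o) (M≡N zero j) (det-cong n λ i k → M≡N (suc i) (punchIn j k)))

  cofactor-cong : ∀ n {M N : Fin (suc n) → Fin (suc n) → A} → (∀ i j → M i j ≡ N i j) →
    ∀ i j → cofactor o n M i j ≡ cofactor o n N i j
  cofactor-cong n M≡N i j = cong (signed o (toℕ i ℕ.+ toℕ j))
    (det-cong n λ p q → M≡N (punchIn i p) (punchIn j q))

  strip-∷ʳ-zero : ∀ xs {x} → isZeroᵒ o x ≡ true → strip o (xs ∷ʳ x) ≡ strip o xs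
  strip-∷ʳ-zero xs {x} x≈0 rewrite reverse-++ xs [ x ] | x≈0 = refl

  strip-∷ʳ-nonzero : ∀ xs {x} → isZeroᵒ o x ≡ false → strip o (xs ∷ʳ x) ≡ xs ∷ʳ x
  strip-∷ʳ-nonzero xs {x} x≉0 rewrite reverse-++ xs [ x ] | x≉0 =
    trans (unfold-reverse x (reverse xs)) (cong (_∷ʳ x) (reverse-involutive xs))

  resultant-of-strips : ∀ f g {x xs y ys} → strip o f ≡ x ∷ xs → strip o g ≡ y ∷ ys →
    resultant o f g ≡
      det o (length ys ℕ.+ length xs) (sylvester o (x ∷ xs) (y ∷ ys) (length xs) (length ys))
  resultant-of-strips f g f≡ g≡ with strip o f | strip o g
  resultant-of-strips f g refl refl | _ | _ = refl

module _ {A B : Set} {oa : Ops A} {ob : Ops B} {h : A → B} (H : IsOpsHom oa ob h) where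
  open IsOpsHom H

  map-addL : ∀ p q → map h (addL oa p q) ≡ addL ob (map h p) (map h q)
  map-addL []      q       = refl
  map-addL (x ∷ p) []      = refl
  map-addL (x ∷ p) (y ∷ q) = cong₂ _∷_ (+-homo x y) (map-addL p q)

  map-scale : ∀ x q → map h (map (mulᵒ oa x) q) ≡ map (mulᵒ ob (h x)) (map h q)
  map-scale x []      = refl
  map-scale x (y ∷ q) = cong₂ _∷_ (*-homo x y) (map-scale x q)

  map-mulL : ∀ p q → map h (mulL oa p q) ≡ mulL ob (map h p) (map h q)
  map-mulL []      q = refl
  map-mulL (x ∷ p) q = trans (map-addL (map (mulᵒ oa x) q) (zeroᵒ oa ∷ mulL oa p q))
    (cong₂ (addL ob) (map-scale x q) (cong₂ _∷_ 0#-homo (map-mulL p q)))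

  map-neg : ∀ p → map h (map (negᵒ oa) p) ≡ map (negᵒ ob) (map h p)
  map-neg []      = refl
  map-neg (x ∷ p) = cong₂ _∷_ (-‿homo x) (map-neg p)

  map-isOpsHom : IsOpsHom (listOps oa) (listOps ob) (map h)
  map-isOpsHom = record
    { 0#-homo = refl ; 1#-homo = cong [_] 1#-homo
    ; +-homo = map-addL ; *-homo = map-mulL ; -‿homo = map-neg }

  sumFin-homo : ∀ n f → h (sumFin oa n f) ≡ sumFin ob n (h ∘ f)
  sumFin-homo zero    f = 0#-homo
  sumFin-homo (suc n) f = trans (+-homo _ _) (cong (addᵒ ob (h (f zero))) (sumFin-homo n (f ∘ suc)))

  signed-homo : ∀ k x → h (signed oa k x) ≡ signed ob k (h x)
  signed-homo zero    x = refl
  signed-homo (suc k) x = trans (-‿homo _) (cong (negᵒ ob) (signed-homo k x))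

  det-homo : ∀ n M → h (det oa n M) ≡ det ob n (λ i j → h (M i j))
  det-homo zero    M = 1#-homo
  det-homo (suc n) M = trans (sumFin-homo (suc n) term) (sumFin-cong ob (suc n) λ j →
    trans (signed-homo (toℕ j) _) (cong (signed ob (toℕ j))
      (trans (*-homo _ _) (cong (mulᵒ ob (h (M zero j))) (det-homo n (minor j))))))
    where
    minor : Fin (suc n) → Fin n → Fin n → A
    minor j i k = M (suc i) (punchIn j k)
    term : Fin (suc n) → A
    term j = signed oa (toℕ j) (mulᵒ oa (M zero j) (det oa n (minor j)))

  cofactor-homo : ∀ n M i j → h (cofactor oa n M i j) ≡ cofactor ob n (λ p q → h (M p q)) i j
  cofactor-homo n M i j =
    trans (signed-homo (toℕ i ℕ.+ toℕ j) _) (cong (signed ob (toℕ i ℕ.+ toℕ j)) (det-homo n _))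

  coeff-homo : ∀ p k → coeff ob (map h p) k ≡ h (coeff oa p k)
  coeff-homo []      k       = sym 0#-homo
  coeff-homo (x ∷ p) zero    = refl
  coeff-homo (x ∷ p) (suc k) = coeff-homo p k

  private
    if-coeff-homo : ∀ b p k → (if b then coeff ob (map h p) k else zeroᵒ ob)
                              ≡ h (if b then coeff oa p k else zeroᵒ oa)
    if-coeff-homo true  p k = coeff-homo p k
    if-coeff-homo false p k = sym 0#-homo

  sylvester-homo : ∀ f g m n r c →
    sylvester ob (map h f) (map h g) m n r c ≡ h (sylvester oa f g m n r c)
  sylvester-homo f g m n r c with toℕ r ℕ.<ᵇ n
  ... | true  = if-coeff-homo _ f _
  ... | false = if-coeff-homo _ g _

Poly : Set → ℕ → Set
Poly A zero    = A
Poly A (suc n) = List (Poly A n)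

module _ {A : Set} (o : Ops A) where

  polyOps : (n : ℕ) → Ops (Poly A n)
  polyOps zero    = o
  polyOps (suc n) = listOps (polyOps n)

  constᵖ : (n : ℕ) → A → Poly A n
  constᵖ zero    a = a
  constᵖ (suc n) a = [ constᵖ n a ]

  varᵖ : {n : ℕ} → Fin n → Poly A n
  varᵖ {suc n} zero    = zeroᵒ (polyOps n) ∷ oneᵒ (polyOps n) ∷ []
  varᵖ {suc n} (suc k) = [ varᵖ k ]

  unitVector : {n : ℕ} → Fin n → Fin n → A
  unitVector zero    zero    = oneᵒ o
  unitVector zero    (suc i) = zeroᵒ o
  unitVector (suc k) zero    = zeroᵒ o
  unitVector (suc k) (suc i) = unitVector k i

  horner : {B : Set} → (B → A) → A → List B → A
  horner f x = foldr (λ q acc → addᵒ o (f q) (mulᵒ o x acc)) (zeroᵒ o)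

  evalPoly : (n : ℕ) → Poly A n → (Fin n → A) → A
  evalPoly zero    a x = a
  evalPoly (suc n) p x = horner (λ q → evalPoly n q (x ∘ suc)) (x zero) p

-- evalPoly ℤOps n, restated for MPoly n: MPoly n and Poly ℤ n agree only for numerals n.
evalℤ : (n : ℕ) → MPoly n → (Fin n → ℤ) → ℤ
evalℤ zero    a x = a
evalℤ (suc n) p x = horner ℤOps (λ q → evalℤ n q (x ∘ suc)) (x zero) p

-- Stated through the Boolean zero test, so that closed instances are proved by refl.
IsConstant : (n : ℕ) → MPoly n → ℤ → Set
IsConstant n p z = isZeroᵒ (mops n) (addᵒ (mops n) p (negᵒ (mops n) (constP n z))) ≡ true

specialise : {A : Set} (n : ℕ) → (A → ℤ) → Poly A n → MPoly n
specialise zero    h = h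
specialise (suc n) h = map (specialise n h)

module _ {A B : Set} {oa : Ops A} {ob : Ops B} {h : A → B} (H : IsOpsHom oa ob h) where
  open IsOpsHom H

  unitVector-homo : ∀ {n} (k i : Fin n) → h (unitVector oa k i) ≡ unitVector ob k i
  unitVector-homo zero    zero    = 1#-homo
  unitVector-homo zero    (suc i) = 0#-homo
  unitVector-homo (suc k) zero    = 0#-homo
  unitVector-homo (suc k) (suc i) = unitVector-homo k i

module _ {A : Set} {o : Ops A} {h : A → ℤ} (H : IsOpsHom o ℤOps h) where
  open IsOpsHom H

  specialise-isOpsHom : ∀ n → IsOpsHom (polyOps o n) (mops n) (specialise n h)
  specialise-isOpsHom zero    = H
  specialise-isOpsHom (suc n) = map-isOpsHom (specialise-isOpsHom n)

  specialise-const : ∀ n a → specialise n h (constᵖ o n a) ≡ constP n (h a)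
  specialise-const zero    a = refl
  specialise-const (suc n) a = cong [_] (specialise-const n a)

  specialise-var : ∀ {n} (k : Fin n) → specialise n h (varᵖ o k) ≡ varP k
  specialise-var {suc n} zero    = cong₂ _∷_ (IsOpsHom.0#-homo (specialise-isOpsHom n))
                                      (cong [_] (IsOpsHom.1#-homo (specialise-isOpsHom n)))
  specialise-var {suc n} (suc k) = cong [_] (specialise-var k)

  evalℤ-specialise : ∀ n p {x : Fin n → A} {y : Fin n → ℤ} → (∀ i → y i ≡ h (x i)) →
    evalℤ n (specialise n h p) y ≡ h (evalPoly o n p x)
  evalℤ-specialise zero    p       y≡hx = refl
  evalℤ-specialise (suc n) []      y≡hx = sym 0#-homo
  evalℤ-specialise (suc n) (q ∷ p) {x} y≡hx = trans
    (cong₂ ℤ._+_ (evalℤ-specialise n q (y≡hx ∘ suc))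
      (cong₂ ℤ._*_ (y≡hx zero) (evalℤ-specialise (suc n) p y≡hx)))
    (sym (trans (+-homo _ _) (cong (ℤ._+_ (h (evalPoly o n q (x ∘ suc)))) (*-homo (x zero) (evalPoly o (suc n) p x)))))

module _ {A : Set} {o : Ops A} {f : A → ℤ} (F : IsOpsHom o ℤOps f) (x : ℤ) where
  open IsOpsHom F
  open +-*-Solver

  private
    eval : List A → ℤ
    eval = horner ℤOps f x

  horner-addL : ∀ p q → eval (addL o p q) ≡ eval p ℤ.+ eval q
  horner-addL []      q       = sym (ℤ.+-identityˡ _)
  horner-addL (a ∷ p) []      = sym (ℤ.+-identityʳ _)
  horner-addL (a ∷ p) (b ∷ q) = trans (cong₂ (λ u v → u ℤ.+ x ℤ.* v) (+-homo a b) (horner-addL p q))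
    (solve 5 (λ a b x u v → (a :+ b) :+ x :* (u :+ v) := (a :+ x :* u) :+ (b :+ x :* v)) refl
      (f a) (f b) x (eval p) (eval q))

  horner-scale : ∀ a q → eval (map (mulᵒ o a) q) ≡ f a ℤ.* eval q
  horner-scale a []      = sym (ℤ.*-zeroʳ (f a))
  horner-scale a (b ∷ q) = trans (cong₂ (λ u v → u ℤ.+ x ℤ.* v) (*-homo a b) (horner-scale a q))
    (solve 4 (λ a b x v → a :* b :+ x :* (a :* v) := a :* (b :+ x :* v)) refl (f a) (f b) x (eval q))

  horner-mulL : ∀ p q → eval (mulL o p q) ≡ eval p ℤ.* eval q
  horner-mulL []      q = sym (ℤ.*-zeroˡ (eval q))
  horner-mulL (a ∷ p) q = trans (horner-addL (map (mulᵒ o a) q) (zeroᵒ o ∷ mulL o p q))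
    (trans (cong₂ ℤ._+_ (horner-scale a q) (cong₂ (λ u v → u ℤ.+ x ℤ.* v) 0#-homo (horner-mulL p q)))
      (solve 4 (λ a x u v → a :* v :+ (con (+ 0) :+ x :* (u :* v)) := (a :+ x :* u) :* v) refl
        (f a) x (eval p) (eval q)))

  horner-neg : ∀ p → eval (map (negᵒ o) p) ≡ ℤ.- eval p
  horner-neg []      = refl
  horner-neg (a ∷ p) = trans (cong₂ (λ u v → u ℤ.+ x ℤ.* v) (-‿homo a) (horner-neg p))
    (solve 3 (λ a x u → :- a :+ x :* (:- u) := :- (a :+ x :* u)) refl (f a) x (eval p))

  horner-isOpsHom : IsOpsHom (listOps o) ℤOps eval
  horner-isOpsHom = record
    { 0#-homo = refl
    ; 1#-homo = trans (cong (λ u → u ℤ.+ x ℤ.* + 0) 1#-homo)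
                  (solve 1 (λ x → con (+ 1) :+ x :* con (+ 0) := con (+ 1)) refl x)
    ; +-homo = horner-addL ; *-homo = horner-mulL ; -‿homo = horner-neg }

evalℤ-isOpsHom : ∀ n (x : Fin n → ℤ) → IsOpsHom (mops n) ℤOps (λ p → evalℤ n p x)
evalℤ-isOpsHom zero    x = record
  { 0#-homo = refl ; 1#-homo = refl ; +-homo = λ _ _ → refl ; *-homo = λ _ _ → refl ; -‿homo = λ _ → refl }
evalℤ-isOpsHom (suc n) x = horner-isOpsHom (evalℤ-isOpsHom n (x ∘ suc)) (x zero)

evalℤ-var : ∀ {n} (k : Fin n) (x : Fin n → ℤ) → evalℤ n (varP k) x ≡ x k
evalℤ-var {suc n} zero    x = trans
  (cong₂ (λ u v → u ℤ.+ x zero ℤ.* (v ℤ.+ x zero ℤ.* + 0)) 0#-homo 1#-homo)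
  (solve 1 (λ a → con (+ 0) :+ a :* (con (+ 1) :+ a :* con (+ 0)) := a) refl (x zero))
  where
  open IsOpsHom (evalℤ-isOpsHom n (x ∘ suc))
  open +-*-Solver
evalℤ-var {suc n} (suc k) x = trans (cong (λ u → u ℤ.+ x zero ℤ.* + 0) (evalℤ-var k (x ∘ suc)))
  (solve 2 (λ a b → a :+ b :* con (+ 0) := a) refl (x (suc k)) (x zero))
  where open +-*-Solver

∧≡true : ∀ {a b} → a ∧ b ≡ true → a ≡ true × b ≡ true
∧≡true {true} b≡true = refl , b≡true

evalℤ-isZero : ∀ n p (x : Fin n → ℤ) → isZeroᵒ (mops n) p ≡ true → evalℤ n p x ≡ + 0
evalℤ-isZero zero    (+ zero) x p≈0 = refl
evalℤ-isZero (suc n) []       x p≈0 = refl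
evalℤ-isZero (suc n) (q ∷ p)  x qp≈0 = trans
  (cong₂ (λ u v → u ℤ.+ x zero ℤ.* v) (evalℤ-isZero n q (x ∘ suc) (proj₁ (∧≡true qp≈0)))
    (evalℤ-isZero (suc n) p x (proj₂ (∧≡true qp≈0))))
  (trans (ℤ.+-identityˡ _) (ℤ.*-zeroʳ (x zero)))

evalℤ≢0⇒¬isZero : ∀ n p (x : Fin n → ℤ) → evalℤ n p x ≢ + 0 → isZeroᵒ (mops n) p ≡ false
evalℤ≢0⇒¬isZero n p x p[x]≢0 with isZeroᵒ (mops n) p in p≈0
... | true  = ⊥-elim (p[x]≢0 (evalℤ-isZero n p x p≈0))
... | false = refl

evalℤ-const : ∀ n z (x : Fin n → ℤ) → evalℤ n (constP n z) x ≡ z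
evalℤ-const zero    z x = refl
evalℤ-const (suc n) z x = trans (cong (λ u → u ℤ.+ x zero ℤ.* + 0) (evalℤ-const n z (x ∘ suc)))
  (trans (cong (ℤ._+_ z) (ℤ.*-zeroʳ (x zero))) (ℤ.+-identityʳ z))

evalℤ-IsConstant : ∀ n p z (x : Fin n → ℤ) → IsConstant n p z → evalℤ n p x ≡ z
evalℤ-IsConstant n p z x p≈z = trans
  (ℤ.i-j≡0⇒i≡j _ _ (trans (sym (trans (+-homo _ _) (cong (ℤ._+_ (evalℤ n p x)) (-‿homo (constP n z)))))
    (evalℤ-isZero n _ x p≈z)))
  (evalℤ-const n z x)
  where open IsOpsHom (evalℤ-isOpsHom n x)

specialise-isZero : {A : Set} {o : Ops A} {h : A → ℤ} → (∀ a → isZeroᵒ o a ≡ true → h a ≡ + 0) →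
  ∀ n p → isZeroᵒ (polyOps o n) p ≡ true → isZeroᵒ (mops n) (specialise n h p) ≡ true
specialise-isZero h0 zero    a       a≈0  = cong (isZeroᵒ ℤOps) (h0 a a≈0)
specialise-isZero h0 (suc n) []      p≈0  = refl
specialise-isZero h0 (suc n) (q ∷ p) qp≈0 = cong₂ _∧_
  (specialise-isZero h0 n q (proj₁ (∧≡true qp≈0)))
  (specialise-isZero h0 (suc n) p (proj₂ (∧≡true qp≈0)))

coefficients : Quartic → Fin 4 → ℤ
coefficients P zero                   = Quartic.c0 P
coefficients P (suc zero)             = Quartic.c1 P
coefficients P (suc (suc zero))       = Quartic.c2 P
coefficients P (suc (suc (suc zero))) = Quartic.c3 P

module _ {A : Set} (o : Ops A) (c : Fin 4 → A) where

  coordPowᵖ : ℕ → Fin 4 → A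
  coordPowᵖ zero    zero    = oneᵒ o
  coordPowᵖ zero    (suc i) = zeroᵒ o
  coordPowᵖ (suc k) zero    = negᵒ o (mulᵒ o (c zero) (coordPowᵖ k (fromℕ 3)))
  coordPowᵖ (suc k) (suc i) =
    addᵒ o (coordPowᵖ k (inject₁ i)) (negᵒ o (mulᵒ o (c (suc i)) (coordPowᵖ k (fromℕ 3))))

  Mαᵖ : Fin 4 → Fin 4 → Poly A 4
  Mαᵖ i j = sumFin (polyOps o 4) 4 λ k →
    mulᵒ (polyOps o 4) (varᵖ o k) (constᵖ o 4 (coordPowᵖ (toℕ k ℕ.+ toℕ j) i))

  NPᵖ : Poly A 4
  NPᵖ = det (polyOps o 4) 4 Mαᵖ

  B14ᵖ : Poly A 4
  B14ᵖ = cofactor (polyOps o 4) 3 Mαᵖ zero (fromℕ 3)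

module _ {A : Set} {o : Ops A} {h : A → ℤ} (H : IsOpsHom o ℤOps h)
         {c : Fin 4 → A} (P : Quartic) (c↦P : ∀ k → h (c k) ≡ coefficients P k) where
  open IsOpsHom H

  private
    minus-times-homo : ∀ {x a y x′ a′ y′} → h x ≡ x′ → h a ≡ a′ → h y ≡ y′ →
      h (addᵒ o x (negᵒ o (mulᵒ o a y))) ≡ x′ ℤ.- a′ ℤ.* y′
    minus-times-homo {x} {a} {y} refl refl refl =
      trans (+-homo x _) (cong (ℤ._+_ (h x)) (trans (-‿homo _) (cong ℤ.-_ (*-homo a y))))

  coordPowᵖ-specialise : ∀ k i → h (coordPowᵖ o c k i) ≡ coordPow P k i
  coordPowᵖ-specialise zero    zero    = 1#-homo
  coordPowᵖ-specialise zero    (suc i) = 0#-homo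
  coordPowᵖ-specialise (suc k) zero    = trans (-‿homo _)
    (cong ℤ.-_ (trans (*-homo _ _) (cong₂ ℤ._*_ (c↦P zero) (coordPowᵖ-specialise k (fromℕ 3)))))
  coordPowᵖ-specialise (suc k) (suc zero) =
    minus-times-homo (coordPowᵖ-specialise k _) (c↦P _) (coordPowᵖ-specialise k (fromℕ 3))
  coordPowᵖ-specialise (suc k) (suc (suc zero)) =
    minus-times-homo (coordPowᵖ-specialise k _) (c↦P _) (coordPowᵖ-specialise k (fromℕ 3))
  coordPowᵖ-specialise (suc k) (suc (suc (suc zero))) =
    minus-times-homo (coordPowᵖ-specialise k _) (c↦P _) (coordPowᵖ-specialise k (fromℕ 3))

  Mαᵖ-specialise : ∀ i j → specialise 4 h (Mαᵖ o c i j) ≡ Mα P i j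
  Mαᵖ-specialise i j = trans (sumFin-homo S 4 term) (sumFin-cong (mops 4) 4 λ k →
    trans (IsOpsHom.*-homo S (varᵖ o k) _) (cong₂ (mulᵒ (mops 4)) (specialise-var H k)
      (trans (specialise-const H 4 _) (cong (constP 4) (coordPowᵖ-specialise (toℕ k ℕ.+ toℕ j) i)))))
    where
    S = specialise-isOpsHom H 4
    term : Fin 4 → Poly A 4
    term k = mulᵒ (polyOps o 4) (varᵖ o k) (constᵖ o 4 (coordPowᵖ o c (toℕ k ℕ.+ toℕ j) i))

  NPᵖ-specialise : specialise 4 h (NPᵖ o c) ≡ NP P
  NPᵖ-specialise = trans (det-homo (specialise-isOpsHom H 4) 4 (Mαᵖ o c))
    (det-cong (mops 4) 4 Mαᵖ-specialise)

  B14ᵖ-specialise : specialise 4 h (B14ᵖ o c) ≡ B14 P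
  B14ᵖ-specialise = trans (cofactor-homo (specialise-isOpsHom H 4) 3 (Mαᵖ o c) zero (fromℕ 3))
    (cofactor-cong (mops 4) 3 Mαᵖ-specialise zero (fromℕ 3))

-- The generic quartic: B₁₄ and N_P as polynomials in a₀,…,a₃ over ℤ[c₀,c₁,c₂,c₃].
-- Opaque, because any unfolding outside the closed computations below is prohibitively expensive.
opaque
  genericB14 genericNP : Poly (MPoly 4) 4
  genericB14 = B14ᵖ (mops 4) varP
  genericNP  = NPᵖ (mops 4) varP

-- bᵍ k and nᵍ k are the coefficients of a₀ᵏ, polynomials in a₁, a₂, a₃; eᵢᵍ is aᵢ = 1, the others 0.
private
  Coeff : Set
  Coeff = Poly (MPoly 4) 3

  bᵍ nᵍ : ℕ → Coeff
  bᵍ = coeff (polyOps (mops 4) 3) genericB14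
  nᵍ = coeff (polyOps (mops 4) 3) genericNP

  Bᵍ Nᵍ : List Coeff
  Bᵍ = bᵍ 0 ∷ bᵍ 1 ∷ bᵍ 2 ∷ []
  Nᵍ = nᵍ 0 ∷ nᵍ 1 ∷ nᵍ 2 ∷ nᵍ 3 ∷ nᵍ 4 ∷ []

  Sᵍ : Fin 6 → Fin 6 → Coeff
  Sᵍ = sylvester (polyOps (mops 4) 3) Bᵍ Nᵍ 2 4

  e₁ᵍ e₃ᵍ : Fin 3 → MPoly 4
  e₁ᵍ = unitVector (mops 4) zero
  e₃ᵍ = unitVector (mops 4) (fromℕ 2)

  Rᵍ[e₁] : MPoly 4
  Rᵍ[e₁] = det (mops 4) 6 λ r c → evalPoly (mops 4) 3 (Sᵍ r c) e₁ᵍ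

opaque
  unfolding genericB14 genericNP

  B14ᵖ-generic : B14ᵖ (mops 4) varP ≡ Bᵍ ∷ʳ bᵍ 3
  B14ᵖ-generic = refl

  NPᵖ-generic : NPᵖ (mops 4) varP ≡ Nᵍ
  NPᵖ-generic = refl

  bᵍ3-isZero : isZeroᵒ (polyOps (mops 4) 3) (bᵍ 3) ≡ true
  bᵍ3-isZero = refl

  bᵍ2[e₃]≡-1 : IsConstant 4 (evalPoly (mops 4) 3 (bᵍ 2) e₃ᵍ) -[1+ 0 ]
  bᵍ2[e₃]≡-1 = refl

  nᵍ4[e₁]≡1 : IsConstant 4 (evalPoly (mops 4) 3 (nᵍ 4) e₁ᵍ) (+ 1)
  nᵍ4[e₁]≡1 = refl

  Rᵍ[e₁]≡1 : IsConstant 4 Rᵍ[e₁] (+ 1)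
  Rᵍ[e₁]≡1 = refl

-- Implicit arguments are given explicitly below: left to unification, they make Agda normalise
-- B14 P, NP P or Rres P with symbolic coefficients, which does not terminate in practice.
module _ (P : Quartic) where

  private
    atP : MPoly 4 → ℤ
    atP p = evalℤ 4 p (coefficients P)

    atP-isOpsHom : IsOpsHom (mops 4) ℤOps atP
    atP-isOpsHom = evalℤ-isOpsHom 4 (coefficients P)

    atP-var : ∀ k → atP (varP k) ≡ coefficients P k
    atP-var k = evalℤ-var k (coefficients P)

    s : Coeff → MPoly 3
    s = specialise 3 atP

    e₁ : Fin 3 → ℤ
    e₁ = unitVector ℤOps zero

    s-at-unitVector : ∀ q (k : Fin 3) z → IsConstant 4 (evalPoly (mops 4) 3 q (unitVector (mops 4) k)) z →
      evalℤ 3 (s q) (unitVector ℤOps k) ≡ z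
    s-at-unitVector q k z q[eₖ]≈z = trans
      (evalℤ-specialise atP-isOpsHom 3 q {unitVector (mops 4) k} λ i → sym (unitVector-homo atP-isOpsHom k i))
      (evalℤ-IsConstant 4 (evalPoly (mops 4) 3 q (unitVector (mops 4) k)) z (coefficients P) q[eₖ]≈z)

    s-nonzero : ∀ q (k : Fin 3) z → IsConstant 4 (evalPoly (mops 4) 3 q (unitVector (mops 4) k)) z →
      z ≢ + 0 → isZeroᵒ (mops 3) (s q) ≡ false
    s-nonzero q k z q[eₖ]≈z z≢0 = evalℤ≢0⇒¬isZero 3 (s q) (unitVector ℤOps k)
      (z≢0 ∘ trans (sym (s-at-unitVector q k z q[eₖ]≈z)))

  B14-coeffs : B14 P ≡ map s Bᵍ ∷ʳ s (bᵍ 3)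
  B14-coeffs = trans (sym (B14ᵖ-specialise atP-isOpsHom {varP} P atP-var))
    (cong (specialise 4 atP) {B14ᵖ (mops 4) varP} B14ᵖ-generic)

  NP-coeffs : NP P ≡ map s Nᵍ
  NP-coeffs = trans (sym (NPᵖ-specialise atP-isOpsHom {varP} P atP-var))
    (cong (specialise 4 atP) {NPᵖ (mops 4) varP} NPᵖ-generic)

  strip-B14 : strip (mops 3) (B14 P) ≡ map s Bᵍ
  strip-B14 = begin
    strip (mops 3) (B14 P)
      ≡⟨ cong (strip (mops 3)) {B14 P} {map s Bᵍ ∷ʳ s (bᵍ 3)} B14-coeffs ⟩
    strip (mops 3) (map s Bᵍ ∷ʳ s (bᵍ 3))
      ≡⟨ strip-∷ʳ-zero (mops 3) (map s Bᵍ) {s (bᵍ 3)}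
           (specialise-isZero {o = mops 4} {h = atP} (λ a → evalℤ-isZero 4 a (coefficients P)) 3 (bᵍ 3) bᵍ3-isZero) ⟩
    strip (mops 3) (map s Bᵍ)
      ≡⟨ strip-∷ʳ-nonzero (mops 3) (s (bᵍ 0) ∷ s (bᵍ 1) ∷ []) {s (bᵍ 2)}
           (s-nonzero (bᵍ 2) (fromℕ 2) -[1+ 0 ] bᵍ2[e₃]≡-1 λ ()) ⟩
    map s Bᵍ ∎
    where open ≡-Reasoning

  strip-NP : strip (mops 3) (NP P) ≡ map s Nᵍ
  strip-NP = trans (cong (strip (mops 3)) {NP P} {map s Nᵍ} NP-coeffs)
    (strip-∷ʳ-nonzero (mops 3) (map s (nᵍ 0 ∷ nᵍ 1 ∷ nᵍ 2 ∷ nᵍ 3 ∷ [])) {s (nᵍ 4)}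
      (s-nonzero (nᵍ 4) zero (+ 1) nᵍ4[e₁]≡1 λ ()))

  Rres-at-e₁ : evalℤ 3 (Rres P) e₁ ≡ + 1
  Rres-at-e₁ = begin
    evalℤ 3 (Rres P) e₁
      ≡⟨ cong (λ R → evalℤ 3 R e₁) {Rres P} {det (mops 3) 6 Sℤ}
           (resultant-of-strips (mops 3) (B14 P) (NP P) strip-B14 strip-NP) ⟩
    evalℤ 3 (det (mops 3) 6 Sℤ) e₁
      ≡⟨ det-homo (evalℤ-isOpsHom 3 e₁) 6 Sℤ ⟩
    det ℤOps 6 (λ r c → evalℤ 3 (Sℤ r c) e₁)
      ≡⟨ det-cong ℤOps 6 entry ⟩
    det ℤOps 6 (λ r c → atP (evalPoly (mops 4) 3 (Sᵍ r c) e₁ᵍ))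
      ≡⟨ det-homo atP-isOpsHom 6 (λ r c → evalPoly (mops 4) 3 (Sᵍ r c) e₁ᵍ) ⟨
    atP Rᵍ[e₁]
      ≡⟨ evalℤ-IsConstant 4 Rᵍ[e₁] (+ 1) (coefficients P) Rᵍ[e₁]≡1 ⟩
    + 1 ∎
    where
    open ≡-Reasoning
    Sℤ : Fin 6 → Fin 6 → MPoly 3
    Sℤ = sylvester (mops 3) (map s Bᵍ) (map s Nᵍ) 2 4
    entry : ∀ r c → evalℤ 3 (Sℤ r c) e₁ ≡ atP (evalPoly (mops 4) 3 (Sᵍ r c) e₁ᵍ)
    entry r c = trans
      (cong (λ q → evalℤ 3 q e₁) {Sℤ r c} {s (Sᵍ r c)}
        (sylvester-homo (specialise-isOpsHom atP-isOpsHom 3) Bᵍ Nᵍ 2 4 r c))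
      (evalℤ-specialise atP-isOpsHom 3 (Sᵍ r c) {e₁ᵍ} λ i → sym (unitVector-homo atP-isOpsHom zero i))

/1≡mkℚ : ∀ a → a ℚ./ 1 ≡ mkℚ a 0 (Coprime.sym (Coprime.1-coprimeTo ℤ.∣ a ∣))
/1≡mkℚ a = ℚ.↥p/↧p≡p (mkℚ a 0 _)

/1-homo-+ : ∀ a b → (a ℤ.+ b) ℚ./ 1 ≡ (a ℚ./ 1) ℚ.+ (b ℚ./ 1)
/1-homo-+ a b = sym (trans (cong₂ ℚ._+_ (/1≡mkℚ a) (/1≡mkℚ b))
  (cong (ℚ._/ 1) (cong₂ ℤ._+_ (ℤ.*-identityʳ a) (ℤ.*-identityʳ b))))

/1-homo-* : ∀ a b → (a ℤ.* b) ℚ./ 1 ≡ (a ℚ./ 1) ℚ.* (b ℚ./ 1)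
/1-homo-* a b = sym (cong₂ ℚ._*_ (/1≡mkℚ a) (/1≡mkℚ b))

module _ {c ℓ : Level} (K : CommutativeRing c ℓ) where
  open CommutativeRing K hiding (zero; refl; sym; trans; reflexive; setoid)
  open CommutativeRing K using (setoid)
    renaming (refl to ≈-refl; sym to ≈-sym; trans to ≈-trans; reflexive to ≈-reflexive)
  open import Relation.Binary.Reasoning.Setoid setoid
  open import Algebra.Properties.Group +-group using (identityˡ-unique)
  open import Algebra.Properties.CommutativeSemigroup *-commutativeSemigroup using (interchange)

  prodPairs-cong : ∀ {f g} → (∀ x y → f x y ≈ g x y) →
    ∀ r1 r2 r3 r4 → prodPairs K f r1 r2 r3 r4 ≈ prodPairs K g r1 r2 r3 r4
  prodPairs-cong f≈g r1 r2 r3 r4 = *-cong (*-cong (*-cong (*-cong (*-cong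
    (f≈g r1 r2) (f≈g r1 r3)) (f≈g r1 r4)) (f≈g r2 r3)) (f≈g r2 r4)) (f≈g r3 r4)

  aEval-X : ∀ x → aEval K 0# 1# 0# 0# x ≈ x
  aEval-X x = begin
    0# + 1# * x + 0# * (x * x) + 0# * (x * x * x)
      ≈⟨ +-cong (+-cong (+-congˡ (*-identityˡ x)) (zeroˡ _)) (zeroˡ _) ⟩
    0# + x + 0# + 0#  ≈⟨ +-identityʳ _ ⟩
    0# + x + 0#       ≈⟨ +-identityʳ _ ⟩
    0# + x            ≈⟨ +-identityˡ x ⟩
    x                 ∎

  sq-diff-aEval-X : ∀ x y → sq K (aEval K 0# 1# 0# 0# x - aEval K 0# 1# 0# 0# y) ≈ sq K (x - y)
  sq-diff-aEval-X x y = *-cong diff diff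
    where diff = +-cong (aEval-X x) (-‿cong (aEval-X y))

  module _ (ι : ℚ → Carrier) (ι-hom : IsRingHomℚ K ι) where

    ι-0 : ι (+ 0 ℚ./ 1) ≈ 0#
    ι-0 = identityˡ-unique _ _ (≈-sym (proj₁ ι-hom 0ℚ 0ℚ))

    ι-+ : ∀ a b → ι ((a ℤ.+ b) ℚ./ 1) ≈ ι (a ℚ./ 1) + ι (b ℚ./ 1)
    ι-+ a b = ≈-trans (≈-reflexive (cong ι (/1-homo-+ a b))) (proj₁ ι-hom _ _)

    ι-* : ∀ a b → ι ((a ℤ.* b) ℚ./ 1) ≈ ι (a ℚ./ 1) * ι (b ℚ./ 1)
    ι-* a b = ≈-trans (≈-reflexive (cong ι (/1-homo-* a b))) (proj₁ (proj₂ ι-hom) _ _)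

    evalP-cong : ∀ n p {x y : Fin n → Carrier} → (∀ i → x i ≈ y i) → evalP K ι n p x ≈ evalP K ι n p y
    evalP-cong zero    p       x≈y = ≈-refl
    evalP-cong (suc n) []      x≈y = ≈-refl
    evalP-cong (suc n) (q ∷ p) x≈y =
      +-cong (evalP-cong n q (x≈y ∘ suc)) (*-cong (x≈y zero) (evalP-cong (suc n) p x≈y))

    evalP-ι : ∀ n p (x : Fin n → ℤ) → evalP K ι n p (λ i → ι (x i ℚ./ 1)) ≈ ι (evalℤ n p x ℚ./ 1)
    evalP-ι zero    p       x = ≈-refl
    evalP-ι (suc n) []      x = ≈-sym ι-0
    evalP-ι (suc n) (q ∷ p) x = begin
      evalP K ι n q (λ i → ι (x (suc i) ℚ./ 1)) + ι (x zero ℚ./ 1) * evalP K ι (suc n) p (λ i → ι (x i ℚ./ 1))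
        ≈⟨ +-cong (evalP-ι n q (x ∘ suc)) (*-congˡ (evalP-ι (suc n) p x)) ⟩
      ι (evalℤ n q (x ∘ suc) ℚ./ 1) + ι (x zero ℚ./ 1) * ι (evalℤ (suc n) p x ℚ./ 1)
        ≈⟨ +-congˡ (ι-* (x zero) (evalℤ (suc n) p x)) ⟨
      ι (evalℤ n q (x ∘ suc) ℚ./ 1) + ι ((x zero ℤ.* evalℤ (suc n) p x) ℚ./ 1)
        ≈⟨ ι-+ (evalℤ n q (x ∘ suc)) (x zero ℤ.* evalℤ (suc n) p x) ⟨
      ι (evalℤ (suc n) (q ∷ p) x ℚ./ 1) ∎

    evalP-Rres-at-e₁ : ∀ P → evalP K ι 3 (Rres P) (pt3 K 1# 0# 0#) ≈ 1#
    evalP-Rres-at-e₁ P = begin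
      evalP K ι 3 (Rres P) (pt3 K 1# 0# 0#)
        ≈⟨ evalP-cong 3 (Rres P) e₁-in-K ⟩
      evalP K ι 3 (Rres P) (λ i → ι (unitVector ℤOps zero i ℚ./ 1))
        ≈⟨ evalP-ι 3 (Rres P) (unitVector ℤOps zero) ⟩
      ι (evalℤ 3 (Rres P) (unitVector ℤOps zero) ℚ./ 1)
        ≡⟨ cong (λ z → ι (z ℚ./ 1)) (Rres-at-e₁ P) ⟩
      ι ℚ.1ℚ
        ≈⟨ proj₂ (proj₂ ι-hom) ⟩
      1# ∎
      where
      e₁-in-K : ∀ i → pt3 K 1# 0# 0# i ≈ ι (unitVector ℤOps zero i ℚ./ 1)
      e₁-in-K zero             = ≈-sym (proj₂ (proj₂ ι-hom))
      e₁-in-K (suc zero)       = ≈-sym ι-0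
      e₁-in-K (suc (suc zero)) = ≈-sym ι-0

  *≉0⇒ˡ≉0 : ∀ {a b} → ¬ a * b ≈ 0# → ¬ a ≈ 0#
  *≉0⇒ˡ≉0 {a} {b} ab≉0 a≈0 = ab≉0 (≈-trans (*-congʳ a≈0) (zeroˡ b))

  *≉0⇒ʳ≉0 : ∀ {a b} → ¬ a * b ≈ 0# → ¬ b ≈ 0#
  *≉0⇒ʳ≉0 {a} {b} ab≉0 b≈0 = ab≉0 (≈-trans (*-congˡ b≈0) (zeroʳ a))

  module _ (inv : Carrier → Carrier) (isField : IsFieldWith K inv) where

    inverse-unique : ∀ {x y} → x * y ≈ 1# → y ≈ inv x
    inverse-unique {x} {y} xy≈1 = begin
      y                ≈⟨ *-identityʳ y ⟨
      y * 1#           ≈⟨ *-congˡ (proj₂ isField x x≉0) ⟨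
      y * (x * inv x)  ≈⟨ *-assoc y x (inv x) ⟨
      y * x * inv x    ≈⟨ *-congʳ (≈-trans (*-comm y x) xy≈1) ⟩
      1# * inv x       ≈⟨ *-identityˡ (inv x) ⟩
      inv x            ∎
      where
      x≉0 : ¬ x ≈ 0#
      x≉0 x≈0 = proj₁ isField (≈-trans (≈-sym xy≈1) (≈-trans (*-congʳ x≈0) (zeroˡ y)))

    inv-* : ∀ {a b} → ¬ a * b ≈ 0# → inv (a * b) ≈ inv a * inv b
    inv-* {a} {b} ab≉0 = ≈-sym (inverse-unique (begin
      a * b * (inv a * inv b)     ≈⟨ interchange a b (inv a) (inv b) ⟩
      a * inv a * (b * inv b)     ≈⟨ *-cong (proj₂ isField a (*≉0⇒ˡ≉0 ab≉0)) (proj₂ isField b (*≉0⇒ʳ≉0 ab≉0)) ⟩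
      1# * 1#                     ≈⟨ *-identityˡ 1# ⟩
      1#                          ∎))

    prodPairs-inv : ∀ f r1 r2 r3 r4 → ¬ prodPairs K f r1 r2 r3 r4 ≈ 0# →
      inv (prodPairs K f r1 r2 r3 r4) ≈ prodPairs K (λ x y → inv (f x y)) r1 r2 r3 r4
    prodPairs-inv f r1 r2 r3 r4 D≉0 =
      ≈-trans (inv-* D≉0) (*-congʳ (
      ≈-trans (inv-* (left D≉0)) (*-congʳ (
      ≈-trans (inv-* (left (left D≉0))) (*-congʳ (
      ≈-trans (inv-* (left (left (left D≉0)))) (*-congʳ (
      inv-* (left (left (left (left D≉0))))))))))))
      where
      left : ∀ {a b} → ¬ a * b ≈ 0# → ¬ a ≈ 0#
      left = *≉0⇒ˡ≉0

lemma5p7 : (c0 c1 c2 c3 : ℤ) → IrreducibleℤX (polyP (quartic c0 c1 c2 c3)) →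
    {c ℓ : Level} (K : CommutativeRing c ℓ) →
    (inv : CommutativeRing.Carrier K → CommutativeRing.Carrier K) → IsFieldWith K inv →
    (ι : ℚ → CommutativeRing.Carrier K) → IsRingHomℚ K ι →
    (r1 r2 r3 r4 : CommutativeRing.Carrier K) → AreRoots K ι (quartic c0 c1 c2 c3) r1 r2 r3 r4 →
    (t : ℚ) → t ≢ 0ℚ → IsTP K ι (quartic c0 c1 c2 c3) r1 r2 r3 r4 t →
    CommutativeRing._≈_ K (ι t)
      (prodPairs K (λ x y → inv (sq K (CommutativeRing._-_ K x y))) r1 r2 r3 r4)
lemma5p7 c0 c1 c2 c3 _ K inv isField ι ι-hom r1 r2 r3 r4 _ t _ isTP =
  ≈-trans (inverse-unique K inv isField (≈-trans (*-comm D (ι t)) (≈-sym 1≈t·D)))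
    (prodPairs-inv K inv isField _ r1 r2 r3 r4 D≉0)
  where
  open CommutativeRing K using (_≈_; _*_; _-_; 0#; 1#; *-comm; *-congˡ; zeroʳ)
    renaming (sym to ≈-sym; trans to ≈-trans)
  open import Relation.Binary.Reasoning.Setoid (CommutativeRing.setoid K)

  P = quartic c0 c1 c2 c3
  X = aEval K 0# 1# 0# 0#
  D = prodPairs K (λ x y → sq K (x - y)) r1 r2 r3 r4

  1≈t·D : 1# ≈ ι t * D
  1≈t·D = begin
    1#                                                       ≈⟨ evalP-Rres-at-e₁ K ι ι-hom P ⟨
    evalP K ι 3 (Rres P) (pt3 K 1# 0# 0#)                    ≈⟨ isTP 0# 1# 0# 0# ⟩
    ι t * prodPairs K (λ x y → sq K (X x - X y)) r1 r2 r3 r4 ≈⟨ *-congˡ (prodPairs-cong K (sq-diff-aEval-X K) r1 r2 r3 r4) ⟩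
    ι t * D                                                  ∎

  D≉0 : ¬ D ≈ 0#
  D≉0 D≈0 = proj₁ isField (≈-trans 1≈t·D (≈-trans (*-congˡ D≈0) (zeroʳ (ι t))))
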